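{- For every triangle-connected graph $T$ with $e(T) \le 2v(T)$ it holds that $T \not\xrightarrow{\mathrm{c-ram}} (K_{1,4}, K_3)$; that is, $T$ has an edge-colouring with no monochromatic copy of $K_{1,4}$ and no rainbow triangle.
   Context: A graph $T$ is triangle-connected if $T$ has no isolated vertices, every edge of $T$ lies in a triangle of $T$, and the $3$-uniform hypergraph on $V(T)$ whose hyperedges are the triangles of $T$ is tightly connected (obtainable from one hyperedge by adding hyperedges one at a time, each sharing two vertices with a previously added one). $G \xrightarrow{\mathrm{c-ram}} (H_1,H_2)$ means every edge-colouring of $G$ contains a monochromatic copy of $H_1$ or a rainbow copy of $H_2$ (all edges distinct colours). $K_{1,4}$ is the star with four edges. -}

module Defs where

open import Data.Nat using (ℕ; _≤_; _*_)
open import Data.Bool using (Bool; true; false; _∧_)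
open import Data.Fin using (Fin; _<_; _<?_)
open import Data.List using (List; []; _∷_; length; filter; cartesianProduct; map; [_])
open import Data.List.Base using ()
open import Data.List.Relation.Unary.Any using (Any)
open import Data.List.Membership.Propositional using (_∈_)
open import Data.Product using (Σ; _×_; _,_; ∃)
open import Data.Sum using (_⊎_)
open import Relation.Binary.PropositionalEquality using (_≡_; _≢_)
open import Relation.Nullary using (¬_; Dec)
open import Relation.Nullary.Decidable using (_×-dec_)
open import Data.Bool using (_≟_)

record Graph (n : ℕ) : Set where
  field
    adj   : Fin n → Fin n → Bool
    sym   : ∀ i j → adj i j ≡ adj j i
    irrefl : ∀ i → adj i i ≡ false
open Graph public

Edge : ∀ {n} → Graph n → Fin n → Fin n → Set
Edge G i j = adj G i j ≡ true

allFin : (n : ℕ) → List (Fin n)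
allFin n = Data.List.Base.allFin n

edgeCount : ∀ {n} → Graph n → ℕ
edgeCount {n} G =
  length (filter (λ p → (Data.Product.proj₁ p <? Data.Product.proj₂ p)
                          ×-dec (adj G (Data.Product.proj₁ p) (Data.Product.proj₂ p) ≟ true))
                 (cartesianProduct (allFin n) (allFin n)))

-- Triangles (hyperedges of the triangle hypergraph), represented as a < b < c.
Tri : ℕ → Set
Tri n = Fin n × Fin n × Fin n

IsTriangle : ∀ {n} → Graph n → Tri n → Set
IsTriangle G (a , b , c) =
  (a < b) × (b < c) × Edge G a b × Edge G b c × Edge G a c

_∈T_ : ∀ {n} → Fin n → Tri n → Set
x ∈T (a , b , c) = x ≡ a ⊎ x ≡ b ⊎ x ≡ c

Share2 : ∀ {n} → Tri n → Tri n → Set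
Share2 {n} s t = Σ (Fin n) λ x → Σ (Fin n) λ y → x ≢ y × x ∈T s × y ∈T s × x ∈T t × y ∈T t

-- A list of hyperedges obtained (read from the end, the head being the most
-- recently added) from one hyperedge by adding hyperedges one at a time,
-- each sharing two vertices with a previously added one.
data Grown {n : ℕ} : List (Tri n) → Set where
  start : ∀ t → Grown [ t ]
  add   : ∀ t ts → Grown ts → Any (Share2 t) ts → Grown (t ∷ ts)

-- The triangle hypergraph of G is tightly connected: all its hyperedges can be
-- produced by such a growth process (using only triangles of G).
TightlyConnectedTriangles : ∀ {n} → Graph n → Set
TightlyConnectedTriangles {n} G =
  Σ (List (Tri n)) λ ts →
    Grown ts
    × Data.List.Relation.Unary.All.All (IsTriangle G) ts
    × (∀ t → IsTriangle G t → t ∈ ts)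
  where import Data.List.Relation.Unary.All

TriangleConnected : ∀ {n} → Graph n → Set
TriangleConnected {n} G =
  (∀ v → Σ (Fin n) λ u → Edge G v u)
  × (∀ u v → Edge G u v → Σ (Fin n) λ w → Edge G u w × Edge G v w)
  × TightlyConnectedTriangles G

-- Edge-colourings: a symmetric colour assignment to pairs (only values on
-- edges matter); colours are natural numbers.
record Colouring {n : ℕ} (G : Graph n) : Set where
  field
    col    : Fin n → Fin n → ℕ
    colSym : ∀ i j → col i j ≡ col j i
open Colouring public

MonoK14 : ∀ {n} {G : Graph n} → Colouring G → Set
MonoK14 {n} {G} c =
  Σ (Fin n) λ v → Σ (Fin n) λ u₁ → Σ (Fin n) λ u₂ → Σ (Fin n) λ u₃ → Σ (Fin n) λ u₄ →
    (u₁ ≢ u₂ × u₁ ≢ u₃ × u₁ ≢ u₄ × u₂ ≢ u₃ × u₂ ≢ u₄ × u₃ ≢ u₄)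
    × (Edge G v u₁ × Edge G v u₂ × Edge G v u₃ × Edge G v u₄)
    × (col c v u₁ ≡ col c v u₂ × col c v u₁ ≡ col c v u₃ × col c v u₁ ≡ col c v u₄)

RainbowK3 : ∀ {n} {G : Graph n} → Colouring G → Set
RainbowK3 {n} {G} c =
  Σ (Fin n) λ a → Σ (Fin n) λ b → Σ (Fin n) λ d →
    (Edge G a b × Edge G b d × Edge G a d)
    × (col c a b ≢ col c b d × col c a b ≢ col c a d × col c b d ≢ col c a d)

ArrowsK14K3 : ∀ {n} → Graph n → Set
ArrowsK14K3 G = (c : Colouring G) → MonoK14 c ⊎ RainbowK3 c

{-# OPTIONS --safe #-}
module Submission where

-- Fix a vertex set R. Building the triangle hypergraph one triangle at a time, every new vertex
-- arrives adjacent to two earlier ones, and along this growth the current vertex set W satisfies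
-- 4|W| ≤ max(6, 4|R ∩ W|) + 2·#(edges of T[W] not inside R). For W = V(T), together with
-- e(T) ≤ 2v(T), this says 2e(T[R]) ≤ 4|R| whenever |R| ≥ 2. So T[R] never has minimum degree 4
-- and a vertex of degree 5: every nonempty R contains a vertex of degree ≤ 3 in T[R], or two
-- adjacent vertices of degree ≤ 4. Peeling such one or two vertices off repeatedly puts the
-- vertices on levels, at most two per level, each vertex having at most three neighbours on higher
-- levels. Colour an edge between levels s < t by 2s and an edge inside level s by 2s + 1: a
-- triangle repeats the colour of its lowest level, and four edges of one colour at v would give v
-- four higher neighbours or put three vertices on one level.

open import Defs
open import Data.Nat using (ℕ; _≤_; _*_)
open import Data.Product using (Σ; _×_)
open import Relation.Nullary using (¬_)

open import Algebra.Properties.Semiring.Sum as Sum using ()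
open import Data.Bool using () renaming (_≟_ to _≟ᵇ_)
open import Data.Bool.Base using (Bool; true; false; _∧_; _∨_; not; if_then_else_)
open import Data.Bool.Properties using (∨-zeroʳ; ∧-zeroʳ; ∧-comm; ¬-not)
open import Data.Empty using (⊥; ⊥-elim)
open import Data.Fin using (_<?_) renaming (_<_ to _<ᶠ_)
open import Data.Fin.Base using (Fin; zero; suc)
open import Data.Fin.Properties using (_≟_; <-cmp; any?)
open import Data.List.Base using (List; []; _∷_; _++_; length; filter; map; tabulate; cartesianProduct)
open import Data.List.Membership.Propositional using (_∈_)
open import Data.List.Properties using (filter-++; length-++; map-tabulate)
open import Data.List.Relation.Unary.All as All using (All; []; _∷_)
open import Data.List.Relation.Unary.AllPairs using ([]; _∷_)
open import Data.List.Relation.Unary.Any using (Any; here; there)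
open import Data.List.Relation.Unary.Unique.Propositional using (Unique)
open import Data.Nat.Base using (zero; suc; _+_; _<_; _⊔_; z≤n; s≤s)
import Data.Nat.Properties as ℕ
open import Data.Nat.Tactic.RingSolver using (solve-∀)
open import Data.Product using (_,_; ∃; proj₁; proj₂)
open import Data.Sum using (_⊎_; inj₁; inj₂; [_,_])
open import Function.Base using (_∘_)
open import Relation.Binary.Definitions using (tri<; tri≈; tri>) renaming (Tri to Trichotomy)
open import Relation.Binary.PropositionalEquality as ≡
  using (_≡_; _≢_; refl; trans; cong; cong₂; subst; subst₂; module ≡-Reasoning)
open import Relation.Nullary using (Dec; yes; no; does)
open import Relation.Nullary.Decidable using (dec-true; dec-false; _×-dec_)

open Sum ℕ.+-*-semiring using (sum; ∑-distrib-+; ∑-comm; sum-cong-≗; sum-replicate-zero; *-distribˡ-sum)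

private variable
  n : ℕ
  a b i j x y z : Fin n
  W W′ : Fin n → Bool
  f g : Fin n → ℕ
  h : Fin n → Fin n → ℕ

⟦_⟧ : Bool → ℕ
⟦ true  ⟧ = 1
⟦ false ⟧ = 0

⟦⟧-mono : ∀ {p q} → (p ≡ true → q ≡ true) → ⟦ p ⟧ ≤ ⟦ q ⟧
⟦⟧-mono {false} _   = z≤n
⟦⟧-mono {true}  p⇒q rewrite p⇒q refl = ℕ.≤-refl

⟦⟧≤1 : ∀ p → ⟦ p ⟧ ≤ 1
⟦⟧≤1 true  = ℕ.≤-refl
⟦⟧≤1 false = z≤n

⟦⟧-pos : ∀ {p} → 0 < ⟦ p ⟧ → p ≡ true
⟦⟧-pos {true} _ = refl

dec-true⁻¹ : ∀ {P : Set} (P? : Dec P) → does P? ≡ true → P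
dec-true⁻¹ (yes p) _ = p

⟦⟧*-mono : ∀ {p m m′} → (p ≡ true → m ≤ m′) → ⟦ p ⟧ * m ≤ ⟦ p ⟧ * m′
⟦⟧*-mono {true}  m≤m′ = ℕ.*-monoʳ-≤ 1 (m≤m′ refl)
⟦⟧*-mono {false} _    = z≤n

∑-mono-≤ : (f g : Fin n → ℕ) → (∀ i → f i ≤ g i) → sum f ≤ sum g
∑-mono-≤ {zero}  f g _   = z≤n
∑-mono-≤ {suc n} f g f≤g = ℕ.+-mono-≤ (f≤g zero) (∑-mono-≤ (f ∘ suc) (g ∘ suc) (f≤g ∘ suc))

∑-mono-< : (f g : Fin n → ℕ) → (∀ i → f i ≤ g i) → f z < g z → sum f < sum g
∑-mono-< {z = zero}  f g f≤g fz<gz =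
  ℕ.+-mono-<-≤ fz<gz (∑-mono-≤ (f ∘ suc) (g ∘ suc) (f≤g ∘ suc))
∑-mono-< {z = suc z} f g f≤g fz<gz =
  ℕ.+-mono-≤-< (f≤g zero) (∑-mono-< (f ∘ suc) (g ∘ suc) (f≤g ∘ suc) fz<gz)

∑-δ : ∀ (z : Fin n) (f : Fin n → ℕ) → sum (λ i → ⟦ does (i ≟ z) ⟧ * f i) ≡ f z
∑-δ {suc n} zero    f = trans (cong₂ _+_ (ℕ.+-identityʳ (f zero)) (sum-replicate-zero n))
                              (ℕ.+-identityʳ (f zero))
∑-δ {suc n} (suc z) f = ∑-δ z (f ∘ suc)

∑-witness : (f : Fin n → ℕ) → 0 < sum f → ∃ λ i → 0 < f i
∑-witness {suc n} f 0<∑ with f zero in f0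
... | suc _ = zero , subst (0 <_) (≡.sym f0) (s≤s z≤n)
... | zero  with i , 0<fi ← ∑-witness (f ∘ suc) 0<∑ = suc i , 0<fi

∅ full : Fin n → Bool
∅ _    = false
full _ = true

_⊆_ : (Fin n → Bool) → (Fin n → Bool) → Set
W ⊆ W′ = ∀ {i} → W i ≡ true → W′ i ≡ true

∈∉-≢ : W x ≡ true → W y ≡ false → x ≢ y
∈∉-≢ Wx Wy refl with () ← trans (≡.sym Wx) Wy

-- These operations, and ∑∈ below, are opaque so that unification can recover their arguments
-- (sum is not injective).
opaque
  insert : Fin n → (Fin n → Bool) → Fin n → Bool
  insert z W i = does (i ≟ z) ∨ W i

  _∩_ _∖_ : (Fin n → Bool) → (Fin n → Bool) → Fin n → Bool
  (W ∩ W′) i = W i ∧ W′ i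
  (W ∖ W′) i = W i ∧ not (W′ i)

opaque
  unfolding insert

  insert-here : insert z W z ≡ true
  insert-here {z = z} rewrite dec-true (z ≟ z) refl = refl

  insert-there : W x ≡ true → insert z W x ≡ true
  insert-there {x = x} {z = z} Wx rewrite Wx = ∨-zeroʳ (does (x ≟ z))

  insert-fresh : x ≢ z → W x ≡ false → insert z W x ≡ false
  insert-fresh {x = x} {z = z} x≢z Wx rewrite dec-false (x ≟ z) x≢z = Wx

  insert-cases : insert z W x ≡ true → x ≡ z ⊎ W x ≡ true
  insert-cases {z = z} {x = x} p with x ≟ z
  ... | yes x≡z = inj₁ x≡z
  ... | no  _   = inj₂ p

  insert-absorb : W z ≡ true → ∀ i → insert z W i ≡ W i
  insert-absorb {z = z} Wz i with i ≟ z
  ... | yes refl = ≡.sym Wz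
  ... | no  _    = refl

opaque
  unfolding _∩_ _∖_

  ∩-intro : W x ≡ true → W′ x ≡ true → (W ∩ W′) x ≡ true
  ∩-intro Wx W′x rewrite Wx | W′x = refl

  ∩-elim : (W ∩ W′) x ≡ true → W x ≡ true × W′ x ≡ true
  ∩-elim {W = W} {x = x} p with W x
  ... | true = refl , p

  ∖-intro : W x ≡ true → W′ x ≡ false → (W ∖ W′) x ≡ true
  ∖-intro Wx W′x rewrite Wx | W′x = refl

  ∖-elim : (W ∖ W′) x ≡ true → W x ≡ true × W′ x ≡ false
  ∖-elim {W = W} {W′ = W′} {x = x} p with W x | W′ x
  ... | true | false = refl , refl

  ∖-out : W′ x ≡ true → (W ∖ W′) x ≡ false
  ∖-out {W′ = W′} {x = x} {W = W} W′x rewrite W′x = ∧-zeroʳ (W x)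

insert-⊆ : W z ≡ true → W′ ⊆ W → insert z W′ ⊆ W
insert-⊆ Wz W′⊆W p with insert-cases p
... | inj₁ refl = Wz
... | inj₂ W′i  = W′⊆W W′i

∖-⊆ : (W ∖ W′) ⊆ W
∖-⊆ = proj₁ ∘ ∖-elim

atLevel : (Fin n → ℕ) → ℕ → Fin n → Bool
atLevel level l u = does (level u ℕ.≟ l)

above : (Fin n → ℕ) → Fin n → Fin n → Bool
above level v u = does (level v ℕ.<? level u)

opaque
  ∑∈ : (Fin n → Bool) → (Fin n → ℕ) → ℕ
  ∑∈ W f = sum (λ i → ⟦ W i ⟧ * f i)

size : (Fin n → Bool) → ℕ
size W = ∑∈ W (λ _ → 1)

opaque
  unfolding ∑∈

  ∑∈-cong : (∀ i → W i ≡ W′ i) → ∑∈ W f ≡ ∑∈ W′ f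
  ∑∈-cong W≗W′ = sum-cong-≗ (λ i → cong (λ p → ⟦ p ⟧ * _) (W≗W′ i))

  ∑∈-congʳ : (∀ i → f i ≡ g i) → ∑∈ W f ≡ ∑∈ W g
  ∑∈-congʳ {W = W} f≗g = sum-cong-≗ (λ i → cong (⟦ W i ⟧ *_) (f≗g i))

  ∑∈-∅ : ∑∈ ∅ f ≡ 0
  ∑∈-∅ {n} = sum-replicate-zero n

  ∑∈-full : ∑∈ full f ≡ sum f
  ∑∈-full {f = f} = sum-cong-≗ (λ i → ℕ.+-identityʳ (f i))

  ∑∈-restrict : ∑∈ W f ≡ ∑∈ full (λ i → ⟦ W i ⟧ * f i)
  ∑∈-restrict {W = W} {f = f} = sum-cong-≗ (λ i → ≡.sym (ℕ.+-identityʳ (⟦ W i ⟧ * f i)))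

  size-full : size {n} full ≡ n
  size-full {zero}  = refl
  size-full {suc n} = cong suc (size-full {n})

  ∑∈-+ : ∑∈ W (λ i → f i + g i) ≡ ∑∈ W f + ∑∈ W g
  ∑∈-+ {W = W} {f = f} {g = g} =
    trans (sum-cong-≗ (λ i → ℕ.*-distribˡ-+ ⟦ W i ⟧ (f i) (g i)))
          (∑-distrib-+ (λ i → ⟦ W i ⟧ * f i) (λ i → ⟦ W i ⟧ * g i))

  ∑∈-* : ∀ c → ∑∈ W (λ i → c * f i) ≡ c * ∑∈ W f
  ∑∈-* {W = W} {f = f} c =
    trans (sum-cong-≗ (λ i → swap ⟦ W i ⟧ c (f i)))
          (≡.sym (*-distribˡ-sum c (λ i → ⟦ W i ⟧ * f i)))
    where
    swap : ∀ p c m → p * (c * m) ≡ c * (p * m)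
    swap = solve-∀

  ∑∈-mono-⊆ : W ⊆ W′ → ∑∈ W f ≤ ∑∈ W′ f
  ∑∈-mono-⊆ {W = W} {W′ = W′} {f = f} W⊆W′ =
    ∑-mono-≤ (λ i → ⟦ W i ⟧ * f i) (λ i → ⟦ W′ i ⟧ * f i) (λ i → ℕ.*-monoˡ-≤ (f i) (⟦⟧-mono W⊆W′))

  ∑∈-mono-< : W z ≡ true → (∀ {i} → W i ≡ true → f i ≤ g i) → f z < g z → ∑∈ W f < ∑∈ W g
  ∑∈-mono-< {W = W} {f = f} {g = g} Wz f≤g fz<gz =
    ∑-mono-< (λ i → ⟦ W i ⟧ * f i) (λ i → ⟦ W i ⟧ * g i) (λ i → ⟦⟧*-mono f≤g)
             (subst (λ p → ⟦ p ⟧ * _ < ⟦ p ⟧ * _) (≡.sym Wz) (ℕ.*-monoʳ-< 1 fz<gz))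

  ∑∈-witness : 0 < ∑∈ W f → ∃ λ i → W i ≡ true × 0 < f i
  ∑∈-witness {W = W} 0<∑ with i , 0<term ← ∑-witness (λ i → ⟦ W i ⟧ * _) 0<∑ with W i in Wi
  ... | true  = i , Wi , subst (0 <_) (ℕ.+-identityʳ _) 0<term
  ... | false = ⊥-elim (ℕ.n≮0 0<term)

opaque
  unfolding ∑∈ insert

  ∑∈-insert : W z ≡ false → ∑∈ (insert z W) f ≡ f z + ∑∈ W f
  ∑∈-insert {W = W} {z = z} {f = f} Wz = begin
    ∑∈ (insert z W) f                                   ≡⟨ sum-cong-≗ split ⟩
    sum (λ i → ⟦ does (i ≟ z) ⟧ * f i + ⟦ W i ⟧ * f i)  ≡⟨ ∑-distrib-+ (λ i → ⟦ does (i ≟ z) ⟧ * f i) _ ⟩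
    sum (λ i → ⟦ does (i ≟ z) ⟧ * f i) + ∑∈ W f         ≡⟨ cong (_+ ∑∈ W f) (∑-δ z f) ⟩
    f z + ∑∈ W f                                        ∎
    where
    open ≡-Reasoning
    split : ∀ i → ⟦ insert z W i ⟧ * f i ≡ ⟦ does (i ≟ z) ⟧ * f i + ⟦ W i ⟧ * f i
    split i with i ≟ z
    ... | yes refl rewrite Wz = ≡.sym (ℕ.+-identityʳ _)
    ... | no  _    = refl

∑∈-singleton : ∑∈ (insert z ∅) f ≡ f z
∑∈-singleton {z = z} {f = f} = trans (∑∈-insert refl) (trans (cong (f z +_) ∑∈-∅) (ℕ.+-identityʳ _))

∑∈-pair : a ≢ b → ∑∈ (insert a (insert b ∅)) f ≡ f a + f b
∑∈-pair {f = f} a≢b = trans (∑∈-insert (insert-fresh a≢b refl)) (cong (f _ +_) ∑∈-singleton)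

∑∈-insert-⊆ : W z ≡ false → insert z W ⊆ W′ → f z + ∑∈ W f ≤ ∑∈ W′ f
∑∈-insert-⊆ {W′ = W′} {f = f} Wz sub = subst (_≤ ∑∈ W′ f) (∑∈-insert Wz) (∑∈-mono-⊆ sub)

∑∈-∖ : W x ≡ true → W′ x ≡ true → f x + ∑∈ (W ∖ W′) f ≤ ∑∈ W f
∑∈-∖ {W = W} {W′ = W′} Wx W′x = ∑∈-insert-⊆ (∖-out {W = W} W′x) (insert-⊆ Wx (∖-⊆ {W′ = W′}))

∑∈-point : W x ≡ true → f x ≤ ∑∈ W f
∑∈-point {W = W} {f = f} Wx =
  subst (_≤ ∑∈ W f) ∑∈-singleton (∑∈-mono-⊆ (insert-⊆ {W′ = ∅} Wx λ ()))

∑∈-pair-≤ : a ≢ b → W a ≡ true → W b ≡ true → f a + f b ≤ ∑∈ W f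
∑∈-pair-≤ {W = W} {f = f} a≢b Wa Wb =
  subst (_≤ ∑∈ W f) (∑∈-pair a≢b) (∑∈-mono-⊆ (insert-⊆ Wa (insert-⊆ {W′ = ∅} Wb λ ())))

∑∈-distinct : ∀ {xs} → Unique xs → All (λ x → W x ≡ true × 1 ≤ f x) xs → length xs ≤ ∑∈ W f
∑∈-distinct []                     []                 = z≤n
∑∈-distinct {W = W} {f = f} (x∉xs ∷ unique) ((Wx , 1≤fx) ∷ members) =
  ℕ.≤-trans (ℕ.+-mono-≤ 1≤fx (∑∈-distinct unique (All.zipWith rest (x∉xs , members))))
            (∑∈-∖ Wx insert-here)
  where
  rest : ∀ {y} → _ ≢ y × (W y ≡ true × 1 ≤ f y) → (W ∖ insert _ ∅) y ≡ true × 1 ≤ f y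
  rest (x≢y , Wy , 1≤fy) = ∖-intro Wy (insert-fresh (x≢y ∘ ≡.sym) refl) , 1≤fy

size-insert-≤ : size (insert z W) ≤ suc (size W)
size-insert-≤ {z = z} {W = W} with W z in Wz
... | true  = ℕ.≤-trans (ℕ.≤-reflexive (∑∈-cong (insert-absorb Wz))) (ℕ.n≤1+n _)
... | false = ℕ.≤-reflexive (∑∈-insert Wz)

size-as-∑∈ : size W ≡ ∑∈ full (⟦_⟧ ∘ W)
size-as-∑∈ {W = W} = trans ∑∈-restrict (∑∈-congʳ (λ i → ℕ.*-identityʳ ⟦ W i ⟧))

pairSum : (Fin n → Bool) → (Fin n → Fin n → ℕ) → ℕ
pairSum W h = ∑∈ W (λ i → ∑∈ W (h i))

pairSum-cong : (∀ i → W i ≡ W′ i) → pairSum W h ≡ pairSum W′ h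
pairSum-cong W≗W′ = trans (∑∈-cong W≗W′) (∑∈-congʳ (λ i → ∑∈-cong W≗W′))

pairSum-pair : a ≢ b → pairSum (insert a (insert b ∅)) h ≡ (h a a + h a b) + (h b a + h b b)
pairSum-pair a≢b = trans (∑∈-congʳ (λ i → ∑∈-pair a≢b)) (∑∈-pair a≢b)

pairSum-insert : (∀ i j → h i j ≡ h j i) → W z ≡ false →
                 pairSum (insert z W) h ≡ h z z + (2 * ∑∈ W (h z) + pairSum W h)
pairSum-insert {h = h} {W = W} {z = z} h-sym Wz = begin
  pairSum (insert z W) h                                     ≡⟨ ∑∈-congʳ (λ i → ∑∈-insert Wz) ⟩
  ∑∈ (insert z W) (λ i → h i z + ∑∈ W (h i))                 ≡⟨ ∑∈-insert Wz ⟩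
  (h z z + ∑∈ W (h z)) + ∑∈ W (λ i → h i z + ∑∈ W (h i))     ≡⟨ cong (h z z + ∑∈ W (h z) +_) ∑∈-+ ⟩
  (h z z + ∑∈ W (h z)) + (∑∈ W (λ i → h i z) + pairSum W h)
    ≡⟨ cong (λ s → (h z z + ∑∈ W (h z)) + (s + pairSum W h)) (∑∈-congʳ (λ i → h-sym i z)) ⟩
  (h z z + ∑∈ W (h z)) + (∑∈ W (h z) + pairSum W h)          ≡⟨ regroup (h z z) (∑∈ W (h z)) _ ⟩
  h z z + (2 * ∑∈ W (h z) + pairSum W h)                     ∎
  where
  open ≡-Reasoning
  regroup : ∀ c d p → (c + d) + (d + p) ≡ c + (2 * d + p)
  regroup = solve-∀

length-filter-tabulate : ∀ {A : Set} {P : A → Set} (P? : ∀ x → Dec (P x)) (f : Fin n → A) →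
                         length (filter P? (tabulate f)) ≡ sum (λ i → ⟦ does (P? (f i)) ⟧)
length-filter-tabulate {zero}  P? f = refl
length-filter-tabulate {suc n} P? f with does (P? (f zero))
... | true  = cong suc (length-filter-tabulate P? (f ∘ suc))
... | false = length-filter-tabulate P? (f ∘ suc)

length-filter-cartesianProduct :
  ∀ {m} {A B : Set} {P : A × B → Set} (P? : ∀ p → Dec (P p)) (f : Fin m → A) (g : Fin n → B) →
  length (filter P? (cartesianProduct (tabulate f) (tabulate g))) ≡
  sum (λ i → sum (λ j → ⟦ does (P? (f i , g j)) ⟧))
length-filter-cartesianProduct {m = zero}  P? f g = refl
length-filter-cartesianProduct {m = suc m} P? f g = begin
  length (filter P? (first ++ rest))                ≡⟨ cong length (filter-++ P? first rest) ⟩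
  length (filter P? first ++ filter P? rest)        ≡⟨ length-++ (filter P? first) ⟩
  length (filter P? first) + length (filter P? rest)
    ≡⟨ cong₂ _+_ (trans (cong (length ∘ filter P?) (map-tabulate g (f zero ,_)))
                        (length-filter-tabulate P? (λ j → f zero , g j)))
                 (length-filter-cartesianProduct P? (f ∘ suc) g) ⟩
  sum (λ j → ⟦ does (P? (f zero , g j)) ⟧) + sum (λ i → sum (λ j → ⟦ does (P? (f (suc i) , g j)) ⟧)) ∎
  where
  open ≡-Reasoning
  first = map (f zero ,_) (tabulate g)
  rest  = cartesianProduct (tabulate (f ∘ suc)) (tabulate g)

degreeBound : ℕ → ℕ
degreeBound r = 6 ⊔ 4 * r

degreeBound-mono : ∀ {r r′} → r ≤ r′ → degreeBound r ≤ degreeBound r′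
degreeBound-mono r≤r′ = ℕ.⊔-monoʳ-≤ 6 (ℕ.*-monoʳ-≤ 4 r≤r′)

degreeBound-large : ∀ {r} → 2 ≤ r → degreeBound r ≡ 4 * r
degreeBound-large 2≤r = ℕ.m≤n⇒m⊔n≡n (ℕ.≤-trans (ℕ.m≤m+n 6 2) (ℕ.*-monoʳ-≤ 4 2≤r))

degreeBound-suc : ∀ {r} → 1 ≤ r → 4 + degreeBound r ≤ degreeBound (suc r) + 2
degreeBound-suc {r} 1≤r = begin
  4 + degreeBound r        ≤⟨ ℕ.+-monoʳ-≤ 4 (ℕ.⊔-lub (ℕ.+-monoʳ-≤ 2 (ℕ.*-monoʳ-≤ 4 1≤r)) (ℕ.m≤n+m (4 * r) 2)) ⟩
  4 + (2 + 4 * r)          ≡⟨ regroup r ⟩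
  4 * suc r + 2            ≤⟨ ℕ.+-monoˡ-≤ 2 (ℕ.m≤n⊔m 6 (4 * suc r)) ⟩
  degreeBound (suc r) + 2  ∎
  where
  open ℕ.≤-Reasoning
  regroup : ∀ r → 4 + (2 + 4 * r) ≡ 4 * suc r + 2
  regroup = solve-∀

degreeBound-edge : ∀ p q → 8 ≤ degreeBound (⟦ p ⟧ + ⟦ q ⟧) + 2 * ⟦ not (p ∧ q) ⟧
degreeBound-edge true  true  = ℕ.≤-refl
degreeBound-edge true  false = ℕ.≤-refl
degreeBound-edge false true  = ℕ.≤-refl
degreeBound-edge false false = ℕ.≤-refl

degreeBound-attach : ∀ p q s r → ⟦ p ⟧ + ⟦ q ⟧ ≤ r →
  4 + degreeBound r ≤ degreeBound (⟦ s ⟧ + r) + 2 * (⟦ not (s ∧ p) ⟧ + ⟦ not (s ∧ q) ⟧)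
degreeBound-attach p     q     false r _   = ℕ.≤-reflexive (ℕ.+-comm 4 (degreeBound r))
degreeBound-attach true  true  true  r 2≤r = begin
  4 + degreeBound r        ≡⟨ cong (4 +_) (degreeBound-large 2≤r) ⟩
  4 + 4 * r                ≡⟨ ℕ.*-suc 4 r ⟨
  4 * suc r                ≤⟨ ℕ.m≤n⊔m 6 (4 * suc r) ⟩
  degreeBound (suc r)      ≤⟨ ℕ.m≤m+n (degreeBound (suc r)) 0 ⟩
  degreeBound (suc r) + 0  ∎
  where open ℕ.≤-Reasoning
degreeBound-attach true  false true  r 1≤r = degreeBound-suc 1≤r
degreeBound-attach false true  true  r 1≤r = degreeBound-suc 1≤r
degreeBound-attach false false true  r _   =
  ℕ.≤-trans (ℕ.≤-reflexive (ℕ.+-comm 4 (degreeBound r))) (ℕ.+-monoˡ-≤ 4 (degreeBound-mono (ℕ.n≤1+n r)))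

-- Degree sums in triangle-connected graphs

module _ {n : ℕ} (T : Graph n) where

  Edge-sym : Edge T x y → Edge T y x
  Edge-sym {x} {y} e = trans (Graph.sym T y x) e

  Edge-irrefl : Edge T x y → x ≢ y
  Edge-irrefl {x} e refl with () ← trans (≡.sym e) (Graph.irrefl T x)

  adjacency : Fin n → Fin n → ℕ
  adjacency i j = ⟦ adj T i j ⟧

  deg : (Fin n → Bool) → Fin n → ℕ
  deg W v = ∑∈ W (adjacency v)

  degreeSum : (Fin n → Bool) → ℕ
  degreeSum W = pairSum W adjacency

  private
    forward : Fin n → Fin n → ℕ
    forward i j = ⟦ does ((i <? j) ×-dec (adj T i j ≟ᵇ true)) ⟧

    forward-edge : i <ᶠ j → forward i j ≡ adjacency i j
    forward-edge {i} {j} i<j rewrite dec-true (i <? j) i<j with adj T i j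
    ... | true  = refl
    ... | false = refl

    adjacency-≤ : ∀ i j → adjacency i j ≤ forward i j + forward j i
    adjacency-≤ i j with <-cmp i j
    ... | tri< i<j _ _  rewrite forward-edge i<j = ℕ.m≤m+n _ _
    ... | tri≈ _ refl _ rewrite Graph.irrefl T i = z≤n
    ... | tri> _ _ j<i  rewrite forward-edge j<i | Graph.sym T j i = ℕ.m≤n+m _ _

  handshake-≤ : degreeSum full ≤ 2 * edgeCount T
  handshake-≤ = begin
    degreeSum full
      ≡⟨ trans ∑∈-full (sum-cong-≗ (λ i → ∑∈-full {f = adjacency i})) ⟩
    sum (λ i → sum (adjacency i))
      ≤⟨ ∑-mono-≤ _ _ (λ i → ∑-mono-≤ (adjacency i) _ (adjacency-≤ i)) ⟩
    sum (λ i → sum (λ j → forward i j + forward j i))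
      ≡⟨ sum-cong-≗ (λ i → ∑-distrib-+ (forward i) _) ⟩
    sum (λ i → sum (forward i) + sum (λ j → forward j i))
      ≡⟨ ∑-distrib-+ (λ i → sum (forward i)) _ ⟩
    e + sum (λ i → sum (λ j → forward j i))
      ≡⟨ cong (e +_) (∑-comm (λ i j → forward j i)) ⟩
    e + e
      ≡⟨ cong (e +_) (≡.sym (ℕ.+-identityʳ e)) ⟩
    2 * e
      ≡⟨ cong (2 *_) edgeCount-sum ⟨
    2 * edgeCount T ∎
    where
    open ℕ.≤-Reasoning
    e = sum (λ i → sum (forward i))
    edgeCount-sum : edgeCount T ≡ e
    edgeCount-sum = length-filter-cartesianProduct
      (λ p → (proj₁ p <? proj₂ p) ×-dec (adj T (proj₁ p) (proj₂ p) ≟ᵇ true)) (λ i → i) (λ j → j)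

  crossing : (Fin n → Bool) → Fin n → Fin n → ℕ
  crossing R i j = ⟦ adj T i j ∧ not (R i ∧ R j) ⟧

  crossing-sym : ∀ R i j → crossing R i j ≡ crossing R j i
  crossing-sym R i j rewrite Graph.sym T i j | ∧-comm (R i) (R j) = refl

  crossing-irrefl : ∀ R i → crossing R i i ≡ 0
  crossing-irrefl R i rewrite Graph.irrefl T i = refl

  crossing-edge : ∀ R → Edge T i j → crossing R i j ≡ ⟦ not (R i ∧ R j) ⟧
  crossing-edge R e rewrite e = refl

  crossing-split : ∀ R → pairSum full (crossing R) + degreeSum R ≡ degreeSum full
  crossing-split R = begin
    pairSum full (crossing R) + ∑∈ R (λ i → ∑∈ R (adjacency i))
      ≡⟨ cong (pairSum full (crossing R) +_)
              (trans ∑∈-restrict (∑∈-congʳ λ i → trans (≡.sym (∑∈-* ⟦ R i ⟧)) ∑∈-restrict)) ⟩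
    pairSum full (crossing R) + ∑∈ full (λ i → ∑∈ full (λ j → ⟦ R j ⟧ * (⟦ R i ⟧ * adjacency i j)))
      ≡⟨ ∑∈-+ ⟨
    ∑∈ full (λ i → ∑∈ full (crossing R i) + ∑∈ full (λ j → ⟦ R j ⟧ * (⟦ R i ⟧ * adjacency i j)))
      ≡⟨ ∑∈-congʳ (λ i → ∑∈-+) ⟨
    ∑∈ full (λ i → ∑∈ full (λ j → crossing R i j + ⟦ R j ⟧ * (⟦ R i ⟧ * adjacency i j)))
      ≡⟨ ∑∈-congʳ (λ i → ∑∈-congʳ (λ j → split (adj T i j) (R i) (R j))) ⟩
    degreeSum full ∎
    where
    open ≡-Reasoning
    split : ∀ e r s → ⟦ e ∧ not (r ∧ s) ⟧ + ⟦ s ⟧ * (⟦ r ⟧ * ⟦ e ⟧) ≡ ⟦ e ⟧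
    split true  true  true  = refl
    split true  true  false = refl
    split true  false true  = refl
    split true  false false = refl
    split false true  true  = refl
    split false true  false = refl
    split false false true  = refl
    split false false false = refl

  Sparse : (R W : Fin n → Bool) → Set
  Sparse R W = 4 * size W ≤ degreeBound (∑∈ W (⟦_⟧ ∘ R)) + pairSum W (crossing R)

  sparse-cong : ∀ {R} → (∀ i → W i ≡ W′ i) → Sparse R W → Sparse R W′
  sparse-cong W≗W′ = subst₂ _≤_ (cong (4 *_) (∑∈-cong W≗W′))
                                (cong₂ _+_ (cong degreeBound (∑∈-cong W≗W′)) (pairSum-cong W≗W′))

  sparse-edge : ∀ {R} → Edge T a b → Sparse R (insert a (insert b ∅))
  sparse-edge {a = a} {b} {R} e = begin
    4 * size (insert a (insert b ∅))                          ≡⟨ cong (4 *_) (∑∈-pair a≢b) ⟩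
    8                                                         ≤⟨ degreeBound-edge (R a) (R b) ⟩
    degreeBound (⟦ R a ⟧ + ⟦ R b ⟧) + 2 * ⟦ not (R a ∧ R b) ⟧
      ≡⟨ cong₂ _+_ (cong degreeBound (∑∈-pair a≢b)) crossings ⟨
    degreeBound (∑∈ (insert a (insert b ∅)) (⟦_⟧ ∘ R)) + pairSum (insert a (insert b ∅)) (crossing R) ∎
    where
    open ℕ.≤-Reasoning
    a≢b = Edge-irrefl e
    crossings : pairSum (insert a (insert b ∅)) (crossing R) ≡ 2 * ⟦ not (R a ∧ R b) ⟧
    crossings rewrite pairSum-pair {h = crossing R} a≢b | crossing-irrefl R a | crossing-irrefl R b
                    | crossing-sym R b a | crossing-edge R e = refl

  sparse-insert : ∀ {R} → Sparse R W → W z ≡ false → x ≢ y → W x ≡ true → W y ≡ true →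
                  Edge T z x → Edge T z y → Sparse R (insert z W)
  sparse-insert {W = W} {z = z} {x = x} {y = y} {R = R} sparse Wz x≢y Wx Wy zx zy = begin
    4 * size (insert z W)          ≡⟨ cong (4 *_) (∑∈-insert Wz) ⟩
    4 * suc (size W)               ≡⟨ ℕ.*-suc 4 (size W) ⟩
    4 + 4 * size W                 ≤⟨ ℕ.+-monoʳ-≤ 4 sparse ⟩
    4 + (degreeBound r + Φ)        ≡⟨ ℕ.+-assoc 4 (degreeBound r) Φ ⟨
    4 + degreeBound r + Φ
      ≤⟨ ℕ.+-monoˡ-≤ Φ (degreeBound-attach (R x) (R y) (R z) r (∑∈-pair-≤ x≢y Wx Wy)) ⟩
    B + 2 * (⟦ not (R z ∧ R x) ⟧ + ⟦ not (R z ∧ R y) ⟧) + Φ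
      ≤⟨ ℕ.+-monoˡ-≤ Φ (ℕ.+-monoʳ-≤ B (ℕ.*-monoʳ-≤ 2 crossings)) ⟩
    B + 2 * D + Φ                  ≡⟨ ℕ.+-assoc B (2 * D) Φ ⟩
    B + (2 * D + Φ)                ≡⟨ cong₂ _+_ (cong degreeBound (∑∈-insert Wz)) pairSum-insert′ ⟨
    degreeBound (∑∈ (insert z W) (⟦_⟧ ∘ R)) + pairSum (insert z W) (crossing R) ∎
    where
    open ℕ.≤-Reasoning
    r = ∑∈ W (⟦_⟧ ∘ R)
    B = degreeBound (⟦ R z ⟧ + r)
    Φ = pairSum W (crossing R)
    D = ∑∈ W (crossing R z)
    crossings : ⟦ not (R z ∧ R x) ⟧ + ⟦ not (R z ∧ R y) ⟧ ≤ D
    crossings = subst₂ (λ p q → p + q ≤ D) (crossing-edge R zx) (crossing-edge R zy) (∑∈-pair-≤ x≢y Wx Wy)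
    pairSum-insert′ : pairSum (insert z W) (crossing R) ≡ 2 * D + Φ
    pairSum-insert′ = trans (pairSum-insert (crossing-sym R) Wz)
                            (cong (_+ (2 * D + Φ)) (crossing-irrefl R z))

  triangle-edge : ∀ {t} → IsTriangle T t → x ∈T t → y ∈T t → x ≢ y → Edge T x y
  triangle-edge (_ , _ , ab , bc , ac) = go
    where
    go : x ∈T _ → y ∈T _ → x ≢ y → Edge T x y
    go (inj₁ refl)        (inj₁ refl)        x≢y = ⊥-elim (x≢y refl)
    go (inj₁ refl)        (inj₂ (inj₁ refl)) _   = ab
    go (inj₁ refl)        (inj₂ (inj₂ refl)) _   = ac
    go (inj₂ (inj₁ refl)) (inj₁ refl)        _   = Edge-sym ab
    go (inj₂ (inj₁ refl)) (inj₂ (inj₁ refl)) x≢y = ⊥-elim (x≢y refl)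
    go (inj₂ (inj₁ refl)) (inj₂ (inj₂ refl)) _   = bc
    go (inj₂ (inj₂ refl)) (inj₁ refl)        _   = Edge-sym ac
    go (inj₂ (inj₂ refl)) (inj₂ (inj₁ refl)) _   = Edge-sym bc
    go (inj₂ (inj₂ refl)) (inj₂ (inj₂ refl)) x≢y = ⊥-elim (x≢y refl)

  sparse-attach : ∀ {R t} → IsTriangle T t → z ∈T t → x ∈T t → y ∈T t → x ≢ y →
                  W x ≡ true → W y ≡ true → Sparse R W → Sparse R (insert z W)
  sparse-attach {z = z} {W = W} tri z∈t x∈t y∈t x≢y Wx Wy sparse with W z in Wz
  ... | true  = sparse-cong (λ i → ≡.sym (insert-absorb Wz i)) sparse
  ... | false = sparse-insert sparse Wz x≢y Wx Wy (edge x∈t Wx) (edge y∈t Wy)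
    where
    edge : ∀ {u} → u ∈T _ → W u ≡ true → Edge T z u
    edge u∈t Wu = triangle-edge tri z∈t u∈t (∈∉-≢ Wu Wz ∘ ≡.sym)

  vertices : List (Tri n) → Fin n → Bool
  vertices []                  = ∅
  vertices ((a , b , c) ∷ ts) = insert a (insert b (insert c (vertices ts)))

  vertices-∷ : ∀ {t ts} → vertices ts x ≡ true → vertices (t ∷ ts) x ≡ true
  vertices-∷ {t = _ , _ , _} = insert-there ∘ insert-there ∘ insert-there

  ∈T⇒vertices : ∀ {t ts} → x ∈T t → vertices (t ∷ ts) x ≡ true
  ∈T⇒vertices {t = _ , _ , _} (inj₁ refl)        = insert-here
  ∈T⇒vertices {t = _ , _ , _} (inj₂ (inj₁ refl)) = insert-there insert-here
  ∈T⇒vertices {t = _ , _ , _} (inj₂ (inj₂ refl)) = insert-there (insert-there insert-here)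

  vertices-∈ : ∀ {t ts} → t ∈ ts → x ∈T t → vertices ts x ≡ true
  vertices-∈ {ts = _ ∷ ts} (here refl)  x∈t = ∈T⇒vertices {ts = ts} x∈t
  vertices-∈ {ts = s ∷ ts} (there t∈ts) x∈t = vertices-∷ {t = s} {ts} (vertices-∈ t∈ts x∈t)

  shared-vertices : ∀ {t ts} → Any (Share2 t) ts →
    Σ (Fin n) λ x → Σ (Fin n) λ y →
      x ≢ y × x ∈T t × y ∈T t × vertices ts x ≡ true × vertices ts y ≡ true
  shared-vertices {ts = _ ∷ ts} (here (x , y , x≢y , x∈t , y∈t , x∈s , y∈s)) =
    x , y , x≢y , x∈t , y∈t , ∈T⇒vertices {ts = ts} x∈s , ∈T⇒vertices {ts = ts} y∈s
  shared-vertices {ts = s ∷ ts} (there share)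
    with x , y , x≢y , x∈t , y∈t , tsx , tsy ← shared-vertices share =
    x , y , x≢y , x∈t , y∈t , vertices-∷ {t = s} {ts} tsx , vertices-∷ {t = s} {ts} tsy

  sparse-vertices : ∀ {R ts} → Grown ts → All (IsTriangle T) ts → Sparse R (vertices ts)
  sparse-vertices (start _) (tri@(_ , _ , _ , bc , _) ∷ []) =
    sparse-attach tri (inj₁ refl) (inj₂ (inj₁ refl)) (inj₂ (inj₂ refl)) (Edge-irrefl bc)
      insert-here (insert-there insert-here) (sparse-edge bc)
  sparse-vertices (add _ _ grown share) (tri ∷ tris)
    with x , y , x≢y , x∈t , y∈t , tsx , tsy ← shared-vertices share =
    sparse-attach tri (inj₁ refl) x∈t y∈t x≢y (insert-there (insert-there tsx))
                                              (insert-there (insert-there tsy))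
      (sparse-attach tri (inj₂ (inj₁ refl)) x∈t y∈t x≢y (insert-there tsx) (insert-there tsy)
        (sparse-attach tri (inj₂ (inj₂ refl)) x∈t y∈t x≢y tsx tsy
          (sparse-vertices grown tris)))

  triangle-place : ∀ {p lo hi} → lo <ᶠ hi → Edge T lo hi → Edge T p lo → Edge T p hi →
                   Σ (Tri n) λ t → IsTriangle T t × p ∈T t
  triangle-place {p} {lo} {hi} lo<hi lo-hi p-lo p-hi with <-cmp p lo
  ... | tri< p<lo _ _  = (p , lo , hi) , (p<lo , lo<hi , p-lo , lo-hi , p-hi) , inj₁ refl
  ... | tri≈ _ p≡lo _ = ⊥-elim (Edge-irrefl p-lo p≡lo)
  ... | tri> _ _ lo<p with <-cmp p hi
  ...   | tri< p<hi _ _ =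
    (lo , p , hi) , (lo<p , p<hi , Edge-sym p-lo , p-hi , lo-hi) , inj₂ (inj₁ refl)
  ...   | tri≈ _ p≡hi _ = ⊥-elim (Edge-irrefl p-hi p≡hi)
  ...   | tri> _ _ hi<p =
    (lo , hi , p) , (lo<hi , hi<p , lo-hi , Edge-sym p-hi , Edge-sym p-lo) , inj₂ (inj₂ refl)

  triangle-through : ∀ {p q r} → Edge T p q → Edge T q r → Edge T p r →
                     Σ (Tri n) λ t → IsTriangle T t × p ∈T t
  triangle-through {q = q} {r} pq qr pr with <-cmp q r
  ... | tri< q<r _ _  = triangle-place q<r qr pq pr
  ... | tri≈ _ q≡r _ = ⊥-elim (Edge-irrefl qr q≡r)
  ... | tri> _ _ r<q  = triangle-place r<q (Edge-sym qr) pr pq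

  vertices-cover : ∀ {ts} → (∀ v → Σ (Fin n) λ u → Edge T v u) →
                   (∀ u v → Edge T u v → Σ (Fin n) λ w → Edge T u w × Edge T v w) →
                   (∀ t → IsTriangle T t → t ∈ ts) → ∀ v → vertices ts v ≡ true
  vertices-cover no-isolated in-triangle complete v
    with u , vu ← no-isolated v
    with w , vw , uw ← in-triangle v u vu
    with t , tri , v∈t ← triangle-through vu uw vw = vertices-∈ (complete t tri) v∈t

  degreeSum-≤ : TriangleConnected T → edgeCount T ≤ 2 * n →
                ∀ {R} → 2 ≤ size R → degreeSum R ≤ 4 * size R
  degreeSum-≤ (no-isolated , in-triangle , ts , grown , tris , complete) e≤2n {R} 2≤|R| =
    ℕ.+-cancelʳ-≤ (4 * n) (degreeSum R) (4 * size R) (begin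
      degreeSum R + 4 * n               ≤⟨ ℕ.+-monoʳ-≤ (degreeSum R) sparse ⟩
      degreeSum R + (4 * size R + X)    ≡⟨ regroup (degreeSum R) (4 * size R) X ⟩
      4 * size R + (X + degreeSum R)    ≡⟨ cong (4 * size R +_) (crossing-split R) ⟩
      4 * size R + degreeSum full       ≤⟨ ℕ.+-monoʳ-≤ (4 * size R) edges ⟩
      4 * size R + 2 * (2 * n)          ≡⟨ cong (4 * size R +_) (ℕ.*-assoc 2 2 n) ⟨
      4 * size R + 4 * n                ∎)
    where
    open ℕ.≤-Reasoning
    X = pairSum full (crossing R)
    edges : degreeSum full ≤ 2 * (2 * n)
    edges = ℕ.≤-trans handshake-≤ (ℕ.*-monoʳ-≤ 2 e≤2n)
    regroup : ∀ a b c → a + (b + c) ≡ b + (c + a)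
    regroup = solve-∀
    sparse : 4 * n ≤ 4 * size R + X
    sparse = begin
      4 * n                                ≡⟨ cong (4 *_) size-full ⟨
      4 * size full                        ≤⟨ sparse-cong (vertices-cover no-isolated in-triangle complete)
                                                          (sparse-vertices grown tris) ⟩
      degreeBound (∑∈ full (⟦_⟧ ∘ R)) + X  ≡⟨ cong (λ r → degreeBound r + X) size-as-∑∈ ⟨
      degreeBound (size R) + X             ≡⟨ cong (_+ X) (degreeBound-large 2≤|R|) ⟩
      4 * size R + X                       ∎

  -- Peeling and layering

  deg-∖ : ∀ {R S v w} → Edge T v w → R w ≡ true → S w ≡ true → suc (deg (R ∖ S) v) ≤ deg R v
  deg-∖ {R} {S} {v} vw Rw Sw =
    subst (λ b → ⟦ b ⟧ + deg (R ∖ S) v ≤ deg R v) vw (∑∈-∖ {W = R} {W′ = S} Rw Sw)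

  record Peeling (R : Fin n → Bool) : Set where
    field
      peeled      : Fin n → Bool
      peeled⊆R    : peeled ⊆ R
      peeled-∋    : ∃ λ v → peeled v ≡ true
      size-peeled : size peeled ≤ 2
      peeled-deg  : ∀ {w} → peeled w ≡ true → deg (R ∖ peeled) w ≤ 3

  peel-vertex : ∀ {R u} → R u ≡ true → deg R u ≤ 3 → Peeling R
  peel-vertex {R} {u} Ru du≤3 = record
    { peeled      = insert u ∅
    ; peeled⊆R    = insert-⊆ Ru (λ ())
    ; peeled-∋    = u , insert-here
    ; size-peeled = ℕ.≤-trans (ℕ.≤-reflexive ∑∈-singleton) (s≤s z≤n)
    ; peeled-deg  = peeled-deg
    }
    where
    peeled-deg : ∀ {w} → insert u ∅ w ≡ true → deg (R ∖ insert u ∅) w ≤ 3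
    peeled-deg p with insert-cases p
    ... | inj₁ refl = ℕ.≤-trans (∑∈-mono-⊆ ∖-⊆) du≤3

  peel-edge : ∀ {R a b} → R a ≡ true → R b ≡ true → Edge T a b → deg R a ≤ 4 → deg R b ≤ 4 → Peeling R
  peel-edge {R} {a} {b} Ra Rb ab da≤4 db≤4 = record
    { peeled      = S
    ; peeled⊆R    = insert-⊆ Ra (insert-⊆ Rb (λ ()))
    ; peeled-∋    = a , insert-here
    ; size-peeled = ℕ.≤-trans size-insert-≤ (s≤s (ℕ.≤-reflexive ∑∈-singleton))
    ; peeled-deg  = peeled-deg
    }
    where
    S = insert a (insert b ∅)
    peeled-deg : ∀ {w} → S w ≡ true → deg (R ∖ S) w ≤ 3
    peeled-deg p with insert-cases p
    ... | inj₁ refl = ℕ.≤-pred (ℕ.≤-trans (deg-∖ ab Rb (insert-there insert-here)) da≤4)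
    ... | inj₂ q with insert-cases q
    ...   | inj₁ refl = ℕ.≤-pred (ℕ.≤-trans (deg-∖ (Edge-sym ab) Ra insert-here) db≤4)

  record Layering (R : Fin n → Bool) : Set where
    field
      level      : Fin n → ℕ
      level-size : ∀ l → size (R ∩ atLevel level l) ≤ 2
      up-deg     : ∀ {v} → R v ≡ true → deg (R ∩ above level v) v ≤ 3

  empty-layering : ∀ {R} → (∀ v → R v ≡ false) → Layering R
  empty-layering {R} empty = record
    { level      = λ _ → 0
    ; level-size = λ _ → ℕ.≤-trans (∑∈-mono-⊆ {W′ = ∅} (⊥-elim ∘ nonmember ∘ proj₁ ∘ ∩-elim))
                                   (ℕ.≤-trans (ℕ.≤-reflexive ∑∈-∅) z≤n)
    ; up-deg     = ⊥-elim ∘ nonmember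
    }
    where
    nonmember : ∀ {v} → R v ≡ true → ⊥
    nonmember {v} Rv = ∈∉-≢ {W = R} Rv (empty v) refl

  stack : ∀ {R} (P : Peeling R) → Layering (R ∖ Peeling.peeled P) → Layering R
  stack {R} P L = record { level = level ; level-size = level-size ; up-deg = up-deg }
    where
    open Peeling P
    module L = Layering L

    level : Fin n → ℕ
    level i = if peeled i then 0 else suc (L.level i)

    level-cases : ∀ u → peeled u ≡ true × level u ≡ 0 ⊎ peeled u ≡ false × level u ≡ suc (L.level u)
    level-cases u with peeled u
    ... | true  = inj₁ (refl , refl)
    ... | false = inj₂ (refl , refl)

    positive⇒unpeeled : ∀ {u} → 0 < level u → peeled u ≡ false × level u ≡ suc (L.level u)
    positive⇒unpeeled {u} 0<ℓu with level-cases u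
    ... | inj₁ (_ , ℓu≡0) = ⊥-elim (ℕ.<⇒≢ 0<ℓu (≡.sym ℓu≡0))
    ... | inj₂ unpeeled   = unpeeled

    bottom : (R ∩ atLevel level 0) ⊆ peeled
    bottom {u} p with level-cases u
    ... | inj₁ (Pu , _)    = Pu
    ... | inj₂ (_ , ℓu≡1+) =
      ⊥-elim (ℕ.0≢1+n (trans (≡.sym (dec-true⁻¹ (level u ℕ.≟ 0) (proj₂ (∩-elim p)))) ℓu≡1+))

    shift : ∀ l → (R ∩ atLevel level (suc l)) ⊆ ((R ∖ peeled) ∩ atLevel L.level l)
    shift l {u} p with Ru , u∈l ← ∩-elim p = ∩-intro (∖-intro Ru Pu) (dec-true (L.level u ℕ.≟ l) ℓ′u≡l)
      where
      ℓu≡1+l = dec-true⁻¹ (level u ℕ.≟ suc l) u∈l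
      unpeeled = positive⇒unpeeled (subst (0 <_) (≡.sym ℓu≡1+l) (s≤s z≤n))
      Pu = proj₁ unpeeled
      ℓ′u≡l = ℕ.suc-injective (trans (≡.sym (proj₂ unpeeled)) ℓu≡1+l)

    level-size : ∀ l → size (R ∩ atLevel level l) ≤ 2
    level-size zero    = ℕ.≤-trans (∑∈-mono-⊆ bottom) size-peeled
    level-size (suc l) = ℕ.≤-trans (∑∈-mono-⊆ (shift l)) (L.level-size l)

    up-deg : ∀ {v} → R v ≡ true → deg (R ∩ above level v) v ≤ 3
    up-deg {v} Rv with level-cases v
    ... | inj₁ (Pv , _) = ℕ.≤-trans (∑∈-mono-⊆ up-unpeeled) (peeled-deg Pv)
      where
      up-unpeeled : (R ∩ above level v) ⊆ (R ∖ peeled)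
      up-unpeeled p with Ru , ℓv<ℓu ← ∩-elim p =
        ∖-intro Ru (proj₁ (positive⇒unpeeled (ℕ.≤-<-trans z≤n (dec-true⁻¹ (_ ℕ.<? _) ℓv<ℓu))))
    ... | inj₂ (Pv , ℓv≡1+) = ℕ.≤-trans (∑∈-mono-⊆ up-shift) (L.up-deg (∖-intro Rv Pv))
      where
      up-shift : (R ∩ above level v) ⊆ ((R ∖ peeled) ∩ above L.level v)
      up-shift p with Ru , ℓv<ℓu ← ∩-elim p
              with ℓv<ℓu′ ← dec-true⁻¹ (_ ℕ.<? _) ℓv<ℓu
              with Pu , ℓu≡1+ ← positive⇒unpeeled (ℕ.≤-<-trans z≤n ℓv<ℓu′) =
        ∩-intro (∖-intro Ru Pu) (dec-true (_ ℕ.<? _) (ℕ.≤-pred (subst₂ _<_ ℓv≡1+ ℓu≡1+ ℓv<ℓu′)))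

module _ {n : ℕ} {T : Graph n} (sparse : ∀ {R} → 2 ≤ size R → degreeSum T R ≤ 4 * size R) where

  no-overfull : ∀ {R w} → (∀ {u} → R u ≡ true → 4 ≤ deg T R u) → R w ≡ true → 5 ≤ deg T R w → ⊥
  no-overfull {R} {w} min4 Rw 5≤dw = ℕ.<⇒≱ dense (sparse 2≤|R|)
    where
    dense : 4 * size R < degreeSum T R
    dense = subst (_< degreeSum T R) (∑∈-* 4) (∑∈-mono-< Rw min4 5≤dw)
    dw<|R| : deg T R w < size R
    dw<|R| = ∑∈-mono-< Rw (λ {i} _ → ⟦⟧≤1 (adj T w i))
               (subst (λ p → ⟦ p ⟧ < 1) (≡.sym (Graph.irrefl T w)) (s≤s z≤n))
    2≤|R| : 2 ≤ size R
    2≤|R| = ℕ.≤-trans (s≤s (s≤s z≤n)) (ℕ.≤-trans 5≤dw (ℕ.<⇒≤ dw<|R|))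

  no-dense : ∀ {R v} → R v ≡ true → (∀ {u} → R u ≡ true → 4 ≤ deg T R u) →
             (∀ {a b} → R a ≡ true → R b ≡ true → Edge T a b → deg T R a ≤ 4 → deg T R b ≤ 4 → ⊥) → ⊥
  no-dense {R} {v} Rv min4 no-pair
    with b , Rb , 0<vb ← ∑∈-witness {W = R} {f = adjacency T v} (ℕ.<-≤-trans (s≤s z≤n) (min4 Rv))
    with deg T R v ℕ.≤? 4 | deg T R b ℕ.≤? 4
  ... | no dv≰4  | _        = no-overfull min4 Rv (ℕ.≰⇒> dv≰4)
  ... | yes _    | no db≰4  = no-overfull min4 Rb (ℕ.≰⇒> db≰4)
  ... | yes dv≤4 | yes db≤4 = no-pair Rv Rb (⟦⟧-pos 0<vb) dv≤4 db≤4

  peel : ∀ {R v} → R v ≡ true → Peeling T R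
  peel {R} {v} Rv with any? (λ u → (R u ≟ᵇ true) ×-dec (deg T R u ℕ.≤? 3))
  ... | yes (u , Ru , du≤3) = peel-vertex T Ru du≤3
  ... | no no-low
    with any? (λ a → ((R a ≟ᵇ true) ×-dec (deg T R a ℕ.≤? 4)) ×-dec
                     any? (λ b → ((R b ≟ᵇ true) ×-dec (adj T a b ≟ᵇ true)) ×-dec (deg T R b ℕ.≤? 4)))
  ...   | yes (a , (Ra , da≤4) , b , (Rb , ab) , db≤4) = peel-edge T Ra Rb ab da≤4 db≤4
  ...   | no no-pair =
    ⊥-elim (no-dense Rv min4 λ Ra Rb ab da≤4 db≤4 → no-pair (_ , (Ra , da≤4) , _ , (Rb , ab) , db≤4))
    where
    min4 : ∀ {u} → R u ≡ true → 4 ≤ deg T R u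
    min4 Ru = ℕ.≰⇒> (λ du≤3 → no-low (_ , Ru , du≤3))

  layering : ∀ {R} k → size R ≤ k → Layering T R
  layering {R} k |R|≤k with any? (λ v → R v ≟ᵇ true)
  ... | no empty = empty-layering T (λ v → ¬-not (λ Rv → empty (v , Rv)))
  layering {R} zero    |R|≤0   | yes (v , Rv) = ⊥-elim (ℕ.<⇒≱ (∑∈-point Rv) |R|≤0)
  layering {R} (suc k) |R|≤1+k | yes (v , Rv) = stack T P (layering k shrunk)
    where
    P = peel Rv
    open Peeling P
    shrunk : size (R ∖ peeled) ≤ k
    shrunk with u , Pu ← peeled-∋ = ℕ.≤-pred (ℕ.≤-trans (∑∈-∖ (peeled⊆R Pu) Pu) |R|≤1+k)

-- Colouring by levels

colourOf : ℕ → ℕ → ℕ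
colourOf s t with ℕ.<-cmp s t
... | tri< _ _ _ = 2 * s
... | tri≈ _ _ _ = suc (2 * s)
... | tri> _ _ _ = 2 * t

colourOf-< : ∀ {s t} → s < t → colourOf s t ≡ 2 * s
colourOf-< {s} {t} s<t with ℕ.<-cmp s t
... | tri< _ _ _   = refl
... | tri≈ s≮t _ _ = ⊥-elim (s≮t s<t)
... | tri> s≮t _ _ = ⊥-elim (s≮t s<t)

colourOf-> : ∀ {s t} → t < s → colourOf s t ≡ 2 * t
colourOf-> {s} {t} t<s with ℕ.<-cmp s t
... | tri< _ _ t≮s = ⊥-elim (t≮s t<s)
... | tri≈ _ _ t≮s = ⊥-elim (t≮s t<s)
... | tri> _ _ _   = refl

colourOf-≡ : ∀ s → colourOf s s ≡ suc (2 * s)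
colourOf-≡ s with ℕ.<-cmp s s
... | tri< _ s≢s _ = ⊥-elim (s≢s refl)
... | tri≈ _ _ _   = refl
... | tri> _ s≢s _ = ⊥-elim (s≢s refl)

colourOf-sym : ∀ s t → colourOf s t ≡ colourOf t s
colourOf-sym s t with ℕ.<-cmp s t
... | tri< s<t _ _  = ≡.sym (colourOf-> s<t)
... | tri≈ _ refl _ = ≡.sym (colourOf-≡ s)
... | tri> _ _ t<s  = ≡.sym (colourOf-< t<s)

same-colour : ∀ {s t t′} → colourOf s t ≡ colourOf s t′ → s < t × s < t′ ⊎ t ≡ t′
same-colour {s} {t} {t′} c with ℕ.<-cmp s t | ℕ.<-cmp s t′
... | tri< s<t _ _  | tri< s<t′ _ _ = inj₁ (s<t , s<t′)
... | tri< _ _ _    | tri≈ _ refl _ = ⊥-elim (ℕ.even≢odd s s c)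
... | tri< _ _ _    | tri> _ _ t′<s = ⊥-elim (ℕ.<⇒≢ t′<s (≡.sym (ℕ.*-cancelˡ-≡ s t′ 2 c)))
... | tri≈ _ refl _ | tri< _ _ _    = ⊥-elim (ℕ.even≢odd s s (≡.sym c))
... | tri≈ _ refl _ | tri≈ _ refl _ = inj₂ refl
... | tri≈ _ refl _ | tri> _ _ _    = ⊥-elim (ℕ.even≢odd t′ s (≡.sym c))
... | tri> _ _ t<s  | tri< _ _ _    = ⊥-elim (ℕ.<⇒≢ t<s (ℕ.*-cancelˡ-≡ t s 2 c))
... | tri> _ _ _    | tri≈ _ refl _ = ⊥-elim (ℕ.even≢odd t s c)
... | tri> _ _ _    | tri> _ _ _    = inj₂ (ℕ.*-cancelˡ-≡ t t′ 2 c)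

colourOf-triangle : ∀ x y z →
  colourOf x y ≡ colourOf y z ⊎ colourOf x y ≡ colourOf x z ⊎ colourOf y z ≡ colourOf x z
colourOf-triangle x y z = by-order (ℕ.<-cmp x y) (ℕ.<-cmp x z) (ℕ.<-cmp y z)
  where
  by-order : Trichotomy (x < y) (x ≡ y) (y < x) → Trichotomy (x < z) (x ≡ z) (z < x) →
             Trichotomy (y < z) (y ≡ z) (z < y) →
             colourOf x y ≡ colourOf y z ⊎ colourOf x y ≡ colourOf x z ⊎ colourOf y z ≡ colourOf x z
  by-order (tri< x<y _ _)  (tri< x<z _ _)  _ = inj₂ (inj₁ (trans (colourOf-< x<y) (≡.sym (colourOf-< x<z))))
  by-order (tri< x<y _ _)  (tri≈ _ refl _) _ = inj₁ (trans (colourOf-< x<y) (≡.sym (colourOf-> x<y)))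
  by-order (tri< x<y _ _)  (tri> _ _ z<x)  _ =
    inj₂ (inj₂ (trans (colourOf-> (ℕ.<-trans z<x x<y)) (≡.sym (colourOf-> z<x))))
  by-order (tri≈ _ refl _) _ _ = inj₂ (inj₂ refl)
  by-order (tri> _ _ y<x)  _ (tri< y<z _ _)  = inj₁ (trans (colourOf-> y<x) (≡.sym (colourOf-< y<z)))
  by-order (tri> _ _ _)    _ (tri≈ _ refl _) = inj₂ (inj₁ refl)
  by-order (tri> _ _ y<x)  _ (tri> _ _ z<y)  =
    inj₂ (inj₂ (trans (colourOf-> z<y) (≡.sym (colourOf-> (ℕ.<-trans z<y y<x)))))

module _ {n : ℕ} {T : Graph n} (L : Layering T full) where
  open Layering L

  levelColouring : Colouring T
  levelColouring = record
    { col    = λ i j → colourOf (level i) (level j)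
    ; colSym = λ i j → colourOf-sym (level i) (level j)
    }

  no-rainbow : ¬ RainbowK3 levelColouring
  no-rainbow (a , b , d , _ , ab≢bd , ab≢ad , bd≢ad) with colourOf-triangle (level a) (level b) (level d)
  ... | inj₁ c        = ab≢bd c
  ... | inj₂ (inj₁ c) = ab≢ad c
  ... | inj₂ (inj₂ c) = bd≢ad c

  no-monochromatic-star : ¬ MonoK14 levelColouring
  no-monochromatic-star
    (v , u₁ , u₂ , u₃ , u₄ , (d₁₂ , d₁₃ , d₁₄ , d₂₃ , d₂₄ , d₃₄) , (e₁ , e₂ , e₃ , e₄) , (c₂ , c₃ , c₄))
    with level v ℕ.<? level u₁
  ... | yes v<u₁ = ℕ.<⇒≱ four-up (up-deg refl)
    where
    up : ∀ {u} → Edge T v u → colourOf (level v) (level u₁) ≡ colourOf (level v) (level u) →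
         (full ∩ above level v) u ≡ true × 1 ≤ adjacency T v u
    up {u} e c = ∩-intro refl (dec-true (level v ℕ.<? level u) (higher (same-colour c)))
           , subst (λ p → 1 ≤ ⟦ p ⟧) (≡.sym e) ℕ.≤-refl
      where
      higher : level v < level u₁ × level v < level u ⊎ level u₁ ≡ level u → level v < level u
      higher (inj₁ (_ , v<u)) = v<u
      higher (inj₂ u₁≡u)      = subst (level v <_) u₁≡u v<u₁
    four-up : 4 ≤ deg T (full ∩ above level v) v
    four-up = ∑∈-distinct ((d₁₂ ∷ d₁₃ ∷ d₁₄ ∷ []) ∷ (d₂₃ ∷ d₂₄ ∷ []) ∷ (d₃₄ ∷ []) ∷ [] ∷ [])
                          (up e₁ refl ∷ up e₂ c₂ ∷ up e₃ c₃ ∷ up e₄ c₄ ∷ [])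
  ... | no v≮u₁ = ℕ.<⇒≱ three-level (level-size (level u₁))
    where
    level-u₁ : ∀ {u} → colourOf (level v) (level u₁) ≡ colourOf (level v) (level u) →
               (full ∩ atLevel level (level u₁)) u ≡ true × 1 ≤ 1
    level-u₁ {u} c = ∩-intro refl (dec-true (level u ℕ.≟ level u₁) (same-level (same-colour c))) , ℕ.≤-refl
      where
      same-level : level v < level u₁ × level v < level u ⊎ level u₁ ≡ level u → level u ≡ level u₁
      same-level (inj₁ (v<u₁ , _)) = ⊥-elim (v≮u₁ v<u₁)
      same-level (inj₂ u₁≡u)       = ≡.sym u₁≡u
    three-level : 3 ≤ size (full ∩ atLevel level (level u₁))
    three-level = ∑∈-distinct ((d₁₂ ∷ d₁₃ ∷ []) ∷ (d₂₃ ∷ []) ∷ [] ∷ [])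
                              (level-u₁ refl ∷ level-u₁ c₂ ∷ level-u₁ c₃ ∷ [])

lemma3p7 : ∀ (n : ℕ) (T : Graph n) → TriangleConnected T → edgeCount T ≤ 2 * n →
           ¬ ArrowsK14K3 T
lemma3p7 n T connected e≤2n arrows =
  [ no-monochromatic-star L , no-rainbow L ] (arrows (levelColouring L))
  where
  L : Layering T full
  L = layering (degreeSum-≤ T connected e≤2n) n (ℕ.≤-reflexive size-full)
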